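{- Let $\mathcal{G}=(L,\vee,\wedge,\odot,\rightarrow,0,1)$ be a right-residuated l-groupoid with derived implication $\Rightarrow$. The following are equivalent: (i) $(x\Rightarrow y)\Rightarrow y=(y\Rightarrow x)\Rightarrow x$ for all $x,y\in L$, and $\mathcal{G}$ is involutive; (ii) $\Rightarrow$ satisfies $(x\Rightarrow y)\Rightarrow y=x\vee y$ for all $x,y\in L$, and $\mathcal{G}$ is involutive; (iii) $\mathcal{G}$ satisfies the double negation law, divisibility, and condition (C).
   Context: A right-residuated l-groupoid is an algebra $(L,\vee,\wedge,\odot,\rightarrow,0,1)$ of type $(2,2,2,2,0,0)$ such that $(L,\vee,\wedge)$ is a lattice with least element $0$ and greatest element $1$, $1\odot x=x$ for all $x$, and $x\odot y\le z$ iff $x\le y\rightarrow z$ for all $x,y,z$. Put $\rceil x:=x\rightarrow 0$; the derived implication is $x\Rightarrow y:=\rceil y\rightarrow\rceil x$. The double negation law is $\rceil\rceil x=x$ for all $x$; $\mathcal{G}$ is involutive if moreover $x\le y$ implies $\rceil y\le\rceil x$. Divisibility: $(x\rightarrow y)\odot x=x\wedge y$ for all $x,y$. Condition (C): $z\le x\odot y$ iff $y\rightarrow\rceil x\le\rceil z$, for all $x,y,z$. -}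

module Defs where

open import Level using (Level; suc; _⊔_)
open import Relation.Binary.PropositionalEquality using (_≡_)
open import Algebra.Lattice.Structures using (IsLattice)
open import Data.Product using (_×_)

record RRLGroupoid (a : Level) : Set (suc a) where
  infixr 6 _∨_
  infixr 7 _∧_
  infixl 8 _⊙_
  infixr 5 _⇾_
  infix 4 _≤_
  field
    L     : Set a
    _∨_   : L → L → L
    _∧_   : L → L → L
    _⊙_   : L → L → L
    _⇾_   : L → L → L
    𝟎     : L
    𝟏     : L
    isLattice : IsLattice _≡_ _∨_ _∧_

  _≤_ : L → L → Set a
  x ≤ y = x ∧ y ≡ x

  field
    𝟎-least    : ∀ x → 𝟎 ≤ x
    𝟏-greatest : ∀ x → x ≤ 𝟏
    𝟏-identityˡ : ∀ x → 𝟏 ⊙ x ≡ x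
    residuation-to   : ∀ x y z → x ⊙ y ≤ z → x ≤ y ⇾ z
    residuation-from : ∀ x y z → x ≤ y ⇾ z → x ⊙ y ≤ z

  ¬_ : L → L
  ¬ x = x ⇾ 𝟎
  infix 9 ¬_

  _⇒_ : L → L → L
  x ⇒ y = (¬ y) ⇾ (¬ x)
  infixr 5 _⇒_

  DoubleNegation : Set a
  DoubleNegation = ∀ x → ¬ ¬ x ≡ x

  Involutive : Set a
  Involutive = DoubleNegation × (∀ x y → x ≤ y → ¬ y ≤ ¬ x)

  Divisibility : Set a
  Divisibility = ∀ x y → (x ⇾ y) ⊙ x ≡ x ∧ y

  ConditionC : Set a
  ConditionC = ∀ x y z → (z ≤ x ⊙ y → (y ⇾ ¬ x) ≤ ¬ z)
                       × ((y ⇾ ¬ x) ≤ ¬ z → z ≤ x ⊙ y)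

-- Under involutivity ¬ is an order anti-automorphism, so De Morgan holds,
-- x ≤ ¬ y ⇔ y ≤ ¬ x, and x ⇒ ¬ y ≡ y ⇾ ¬ x.  The hub of the equivalence is
-- the duality x ⊙ y ≡ ¬ (y ⇾ ¬ x): condition (C) is this duality read through
-- the Galois connection; the join law makes w ⊙ y ≤ ¬ x symmetric in w and x,
-- which yields the duality; and given the duality, divisibility at (¬ y, ¬ x)
-- is the De Morgan dual of the join law.  Symmetry gives the join law by
-- instantiating it at (x ∨ y, y), where y ⇒ (x ∨ y) ≡ 𝟏.
module Submission where

open import Defs
open import Level using (Level)
open import Relation.Binary.PropositionalEquality
  using (_≡_; sym; trans; cong; cong₂; subst; isEquivalence; module ≡-Reasoning)
open import Data.Product using (_×_; _,_; proj₁; proj₂)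
open import Algebra.Lattice.Bundles using (Lattice)
open import Algebra.Lattice.Structures using (IsLattice)
import Algebra.Lattice.Properties.Lattice as LatticeProperties
open import Relation.Binary.Bundles using (Poset)
open import Relation.Binary.Structures using (IsPartialOrder)
import Relation.Binary.Lattice as OrderLattice
import Relation.Binary.Reasoning.PartialOrder as PartialOrderReasoning

module Properties {a : Level} (G : RRLGroupoid a) where
  open RRLGroupoid G
  open IsLattice isLattice using (∨-comm; ∧-comm)

  lattice : Lattice a a
  lattice = record
    { Carrier = L ; _≈_ = _≡_ ; _∨_ = _∨_ ; _∧_ = _∧_ ; isLattice = isLattice }

  -- The library's natural order is x ≡ x ∧ y, the symmetric form of _≤_.
  private
    module ∧-Order = OrderLattice.Lattice
      (LatticeProperties.∨-∧-orderTheoreticLattice lattice)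

  ≤-isPartialOrder : IsPartialOrder _≡_ _≤_
  ≤-isPartialOrder = record
    { isPreorder = record
      { isEquivalence = isEquivalence
      ; reflexive     = λ x≡y → sym (∧-Order.reflexive x≡y)
      ; trans         = λ x≤y y≤z → sym (∧-Order.trans (sym x≤y) (sym y≤z))
      }
    ; antisym = λ x≤y y≤x → ∧-Order.antisym (sym x≤y) (sym y≤x)
    }

  ≤-poset : Poset a a a
  ≤-poset = record { isPartialOrder = ≤-isPartialOrder }

  open Poset ≤-poset
    using () renaming (refl to ≤-refl; reflexive to ≤-reflexive; trans to ≤-trans; antisym to ≤-antisym)

  module ≤-Reasoning = PartialOrderReasoning ≤-poset

  x≤x∨y : ∀ x y → x ≤ x ∨ y
  x≤x∨y x y = sym (∧-Order.x≤x∨y x y)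

  y≤x∨y : ∀ x y → y ≤ x ∨ y
  y≤x∨y x y = sym (∧-Order.y≤x∨y x y)

  ∨-least : ∀ {x y z} → x ≤ z → y ≤ z → x ∨ y ≤ z
  ∨-least x≤z y≤z = sym (∧-Order.∨-least (sym x≤z) (sym y≤z))

  x∧y≤x : ∀ x y → x ∧ y ≤ x
  x∧y≤x x y = sym (∧-Order.x∧y≤x x y)

  x∧y≤y : ∀ x y → x ∧ y ≤ y
  x∧y≤y x y = sym (∧-Order.x∧y≤y x y)

  ∧-greatest : ∀ {x y z} → x ≤ y → x ≤ z → x ≤ y ∧ z
  ∧-greatest x≤y x≤z = sym (∧-Order.∧-greatest (sym x≤y) (sym x≤z))

  ⇾-counit : ∀ x y → (x ⇾ y) ⊙ x ≤ y
  ⇾-counit x y = residuation-from (x ⇾ y) x y ≤-refl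

  ⇾-monoʳ : ∀ x {y z} → y ≤ z → x ⇾ y ≤ x ⇾ z
  ⇾-monoʳ x y≤z = residuation-to _ x _ (≤-trans (⇾-counit x _) y≤z)

  ⇾-≡𝟏 : ∀ {x y} → x ≤ y → x ⇾ y ≡ 𝟏
  ⇾-≡𝟏 {x} {y} x≤y = ≤-antisym (𝟏-greatest (x ⇾ y))
    (residuation-to 𝟏 x y (subst (_≤ y) (sym (𝟏-identityˡ x)) x≤y))

  ¬𝟎≡𝟏 : ¬ 𝟎 ≡ 𝟏
  ¬𝟎≡𝟏 = ⇾-≡𝟏 ≤-refl

  DerivedSymmetry : Set a
  DerivedSymmetry = ∀ x y → (x ⇒ y) ⇒ y ≡ (y ⇒ x) ⇒ x

  DerivedJoin : Set a
  DerivedJoin = ∀ x y → (x ⇒ y) ⇒ y ≡ x ∨ y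

  ProductDuality : Set a
  ProductDuality = ∀ x y → x ⊙ y ≡ ¬ (y ⇾ ¬ x)

  ProductSwap : Set a
  ProductSwap = ∀ w x y → w ⊙ y ≤ ¬ x → x ⊙ y ≤ ¬ w

  derivedJoin⇒derivedSymmetry : DerivedJoin → DerivedSymmetry
  derivedJoin⇒derivedSymmetry join x y =
    trans (join x y) (trans (∨-comm x y) (sym (join y x)))

  module DoubleNegationProperties (dn : DoubleNegation) where

    ¬𝟏≡𝟎 : ¬ 𝟏 ≡ 𝟎
    ¬𝟏≡𝟎 = trans (cong ¬_ (sym ¬𝟎≡𝟏)) (dn 𝟎)

    𝟏⇒x≡x : ∀ x → 𝟏 ⇒ x ≡ x
    𝟏⇒x≡x x = trans (cong (¬ x ⇾_) ¬𝟏≡𝟎) (dn x)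

    y≤[x⇒y]⇒y : ∀ x y → y ≤ (x ⇒ y) ⇒ y
    y≤[x⇒y]⇒y x y = residuation-to y (¬ y) _
      (≤-trans (residuation-from y (¬ y) 𝟎 (≤-reflexive (sym (dn y)))) (𝟎-least _))

    ⇒¬≡⇾¬ : ∀ x y → x ⇒ ¬ y ≡ y ⇾ ¬ x
    ⇒¬≡⇾¬ x y = cong (_⇾ ¬ x) (dn y)

    conditionC⇒¬-antitone : ConditionC → ∀ x y → x ≤ y → ¬ y ≤ ¬ x
    conditionC⇒¬-antitone C x y x≤y = subst (λ v → y ⇾ v ≤ ¬ x) ¬𝟏≡𝟎
      (proj₁ (C 𝟏 y x) (subst (x ≤_) (sym (𝟏-identityˡ y)) x≤y))

  module Involution (dn : DoubleNegation) (¬-antitone : ∀ x y → x ≤ y → ¬ y ≤ ¬ x) where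
    open DoubleNegationProperties dn

    ≤¬-swap : ∀ {x y} → x ≤ ¬ y → y ≤ ¬ x
    ≤¬-swap {x} {y} x≤¬y = subst (_≤ ¬ x) (dn y) (¬-antitone x (¬ y) x≤¬y)

    ¬≤-swap : ∀ {x y} → ¬ x ≤ y → ¬ y ≤ x
    ¬≤-swap {x} {y} ¬x≤y = subst (¬ y ≤_) (dn x) (¬-antitone (¬ x) y ¬x≤y)

    ¬-∨ : ∀ x y → ¬ (x ∨ y) ≡ ¬ x ∧ ¬ y
    ¬-∨ x y = ≤-antisym
      (∧-greatest (¬-antitone _ _ (x≤x∨y x y)) (¬-antitone _ _ (y≤x∨y x y)))
      (≤¬-swap (∨-least (≤¬-swap (x∧y≤x (¬ x) (¬ y))) (≤¬-swap (x∧y≤y (¬ x) (¬ y)))))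

    ¬-∧ : ∀ x y → ¬ (x ∧ y) ≡ ¬ x ∨ ¬ y
    ¬-∧ x y = begin
      ¬ (x ∧ y)          ≡⟨ cong ¬_ (cong₂ _∧_ (dn x) (dn y)) ⟨
      ¬ (¬ ¬ x ∧ ¬ ¬ y)  ≡⟨ cong ¬_ (¬-∨ (¬ x) (¬ y)) ⟨
      ¬ ¬ (¬ x ∨ ¬ y)    ≡⟨ dn (¬ x ∨ ¬ y) ⟩
      ¬ x ∨ ¬ y          ∎
      where open ≡-Reasoning

    ⇒-antitoneˡ : ∀ {x y} z → x ≤ y → y ⇒ z ≤ x ⇒ z
    ⇒-antitoneˡ z x≤y = ⇾-monoʳ (¬ z) (¬-antitone _ _ x≤y)

    ⇒-≡𝟏 : ∀ {x y} → x ≤ y → x ⇒ y ≡ 𝟏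
    ⇒-≡𝟏 x≤y = ⇾-≡𝟏 (¬-antitone _ _ x≤y)

    derivedSymmetry⇒derivedJoin : DerivedSymmetry → DerivedJoin
    derivedSymmetry⇒derivedJoin symmetry x y = ≤-antisym upper lower
      where
      open ≤-Reasoning
      upper : (x ⇒ y) ⇒ y ≤ x ∨ y
      upper = begin
        (x ⇒ y) ⇒ y              ≤⟨ ⇒-antitoneˡ y (⇒-antitoneˡ y (x≤x∨y x y)) ⟩
        ((x ∨ y) ⇒ y) ⇒ y        ≡⟨ symmetry (x ∨ y) y ⟩
        (y ⇒ (x ∨ y)) ⇒ (x ∨ y)  ≡⟨ cong (_⇒ (x ∨ y)) (⇒-≡𝟏 (y≤x∨y x y)) ⟩
        𝟏 ⇒ (x ∨ y)              ≡⟨ 𝟏⇒x≡x (x ∨ y) ⟩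
        x ∨ y                    ∎
      lower : x ∨ y ≤ (x ⇒ y) ⇒ y
      lower = ∨-least (subst (x ≤_) (symmetry y x) (y≤[x⇒y]⇒y y x)) (y≤[x⇒y]⇒y x y)

    derivedJoin⇒productSwap : DerivedJoin → ProductSwap
    derivedJoin⇒productSwap join w x y wy≤¬x = residuation-from x y (¬ w) (begin
      x                ≤⟨ x≤x∨y x (¬ y) ⟩
      x ∨ ¬ y          ≡⟨ join x (¬ y) ⟨
      (x ⇒ ¬ y) ⇒ ¬ y  ≤⟨ ⇒-antitoneˡ (¬ y) w≤x⇒¬y ⟩
      w ⇒ ¬ y          ≡⟨ ⇒¬≡⇾¬ w y ⟩
      y ⇾ ¬ w          ∎)
      where
      open ≤-Reasoning
      w≤x⇒¬y : w ≤ x ⇒ ¬ y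
      w≤x⇒¬y = subst (w ≤_) (sym (⇒¬≡⇾¬ x y)) (residuation-to w y (¬ x) wy≤¬x)

    productSwap⇒productDuality : ProductSwap → ProductDuality
    productSwap⇒productDuality swap x y = ≤-antisym
      (swap (y ⇾ ¬ x) x y (⇾-counit y (¬ x)))
      (¬≤-swap (residuation-to _ y (¬ x)
        (swap x (¬ (x ⊙ y)) y (≤-reflexive (sym (dn (x ⊙ y)))))))

    productDuality⇒conditionC : ProductDuality → ConditionC
    productDuality⇒conditionC duality x y z =
      (λ z≤xy → ≤¬-swap (subst (z ≤_) (duality x y) z≤xy)) ,
      (λ t≤¬z → subst (z ≤_) (sym (duality x y)) (≤¬-swap t≤¬z))

    conditionC⇒productDuality : ConditionC → ProductDuality
    conditionC⇒productDuality C x y = ≤-antisym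
      (≤¬-swap (proj₁ (C x y (x ⊙ y)) ≤-refl))
      (proj₂ (C x y (¬ (y ⇾ ¬ x))) (≤-reflexive (sym (dn (y ⇾ ¬ x)))))

    productDuality⇒divisibility : DerivedJoin → ProductDuality → Divisibility
    productDuality⇒divisibility join duality x y = begin
      (x ⇾ y) ⊙ x              ≡⟨ duality (x ⇾ y) x ⟩
      ¬ (x ⇾ ¬ (x ⇾ y))        ≡⟨ cong (λ v → ¬ (x ⇾ ¬ (x ⇾ v))) (dn y) ⟨
      ¬ (x ⇾ ¬ (x ⇾ ¬ ¬ y))    ≡⟨ cong (λ v → ¬ (x ⇾ ¬ v)) (⇒¬≡⇾¬ (¬ y) x) ⟨
      ¬ (x ⇾ ¬ (¬ y ⇒ ¬ x))    ≡⟨ cong ¬_ (⇒¬≡⇾¬ (¬ y ⇒ ¬ x) x) ⟨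
      ¬ ((¬ y ⇒ ¬ x) ⇒ ¬ x)    ≡⟨ cong ¬_ (join (¬ y) (¬ x)) ⟩
      ¬ (¬ y ∨ ¬ x)            ≡⟨ ¬-∨ (¬ y) (¬ x) ⟩
      ¬ ¬ y ∧ ¬ ¬ x            ≡⟨ cong₂ _∧_ (dn y) (dn x) ⟩
      y ∧ x                    ≡⟨ ∧-comm y x ⟩
      x ∧ y                    ∎
      where open ≡-Reasoning

    productDuality⇒derivedJoin : Divisibility → ProductDuality → DerivedJoin
    productDuality⇒derivedJoin divisibility duality x y = begin
      (x ⇒ y) ⇒ y          ≡⟨ dn ((x ⇒ y) ⇒ y) ⟨
      ¬ ¬ ((x ⇒ y) ⇒ y)    ≡⟨ cong ¬_ (duality (x ⇒ y) (¬ y)) ⟨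
      ¬ ((x ⇒ y) ⊙ ¬ y)    ≡⟨ cong ¬_ (divisibility (¬ y) (¬ x)) ⟩
      ¬ (¬ y ∧ ¬ x)        ≡⟨ ¬-∧ (¬ y) (¬ x) ⟩
      ¬ ¬ y ∨ ¬ ¬ x        ≡⟨ cong₂ _∨_ (dn y) (dn x) ⟩
      y ∨ x                ≡⟨ ∨-comm y x ⟩
      x ∨ y                ∎
      where open ≡-Reasoning

proposition4 : ∀ {a : Level} (G : RRLGroupoid a) → let open RRLGroupoid G in
    (((∀ x y → (x ⇒ y) ⇒ y ≡ (y ⇒ x) ⇒ x) × Involutive)
      → ((∀ x y → (x ⇒ y) ⇒ y ≡ x ∨ y) × Involutive))
    × (((∀ x y → (x ⇒ y) ⇒ y ≡ x ∨ y) × Involutive)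
      → (DoubleNegation × Divisibility × ConditionC))
    × ((DoubleNegation × Divisibility × ConditionC)
      → ((∀ x y → (x ⇒ y) ⇒ y ≡ (y ⇒ x) ⇒ x) × Involutive))
proposition4 G = i⇒ii , ii⇒iii , iii⇒i
  where
  open RRLGroupoid G
  open Properties G

  i⇒ii : DerivedSymmetry × Involutive → DerivedJoin × Involutive
  i⇒ii (symmetry , involutive@(dn , ¬-antitone)) =
    derivedSymmetry⇒derivedJoin symmetry , involutive
    where open Involution dn ¬-antitone

  ii⇒iii : DerivedJoin × Involutive → DoubleNegation × Divisibility × ConditionC
  ii⇒iii (join , (dn , ¬-antitone)) =
    dn , productDuality⇒divisibility join duality , productDuality⇒conditionC duality
    where
    open Involution dn ¬-antitone
    duality : ProductDuality
    duality = productSwap⇒productDuality (derivedJoin⇒productSwap join)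

  iii⇒i : DoubleNegation × Divisibility × ConditionC → DerivedSymmetry × Involutive
  iii⇒i (dn , divisibility , C) =
    derivedJoin⇒derivedSymmetry
      (productDuality⇒derivedJoin divisibility (conditionC⇒productDuality C)) ,
    (dn , ¬-antitone)
    where
    open DoubleNegationProperties dn
    ¬-antitone : ∀ x y → x ≤ y → ¬ y ≤ ¬ x
    ¬-antitone = conditionC⇒¬-antitone C
    open Involution dn ¬-antitone
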